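{- Let $v\ge 4$, $d\ge1$. For every $D\in\mathcal{D}_{v,d}(132)$, the labels on each diamond, read in the order used to form $\pi_D$, are increasing; that is, $\pi_D(v(i-1)+1)<\pi_D(v(i-1)+2)<\cdots<\pi_D(vi)$ for each $i=1,\dots,d$.
   Context: A diamond with $v$ vertices ($v\ge4$) is the poset with a least element, a greatest element, and $v-2$ pairwise incomparable middle elements (in a fixed left-to-right order) strictly between them. $\mathcal{D}_{v,d}$ is the set of labellings of $d$ diamonds (placed left to right) by $1,\dots,vd$, each label used once, such that in each diamond least label $<$ each middle label $<$ greatest label. For $D\in\mathcal{D}_{v,d}$, $\pi_D$ is the permutation of $\{1,\dots,vd\}$ obtained by reading the diamonds from left to right and, within each diamond, the least element, then the middle elements from left to right, then the greatest element (so the $i$-th diamond occupies positions $v(i-1)+1,\dots,vi$). $\mathcal{D}_{v,d}(P)$ is the set of $D$ with $\pi_D$ avoiding (in the classical sense) every pattern in $P$. -}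

module Defs where

open import Data.Nat using (ℕ; suc; _*_; _≤_; _<_; _∸_)
open import Data.Fin as Fin using (Fin; toℕ; quotient; remainder; combine)
open import Data.Product using (_×_; Σ; ∃-syntax; _,_)
open import Relation.Binary.PropositionalEquality using (_≡_)
open import Relation.Nullary using (¬_)

-- A labelling of d diamonds with v vertices each: L i j is the label of
-- the j-th vertex of diamond i, where vertex 0 is the least element,
-- vertices 1..v-2 are the middle elements (left to right) and vertex v-1
-- is the greatest element (i.e. the reading order used for π_D).
Labelling : ℕ → ℕ → Set
Labelling v d = Fin d → Fin v → ℕ

-- π_D as a sequence indexed by positions 0..dv-1 (position combine i j = v*i + j,
-- i.e. 1-based position v(i-1)+j+1 in the paper's convention).
πD : ∀ {v d} → Labelling v d → Fin (d * v) → ℕ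
πD {v} {d} L p = L (quotient {d} v p) (remainder {d} v p)

IsBijectiveLabelling : ∀ {v d} → Labelling v d → Set
IsBijectiveLabelling {v} {d} L =
  (∀ p → 1 ≤ πD L p × πD L p ≤ d * v) ×
  (∀ p q → πD L p ≡ πD L q → p ≡ q)

IsDiamondLabelling : ∀ {v d} → Labelling v d → Set
IsDiamondLabelling {v} {d} L =
  ∀ (i : Fin d) (z j g : Fin v) → toℕ z ≡ 0 → toℕ g ≡ v ∸ 1 →
    0 < toℕ j → toℕ j < v ∸ 1 →
    L i z < L i j × L i j < L i g

InD : (v d : ℕ) → Labelling v d → Set
InD v d L = IsBijectiveLabelling L × IsDiamondLabelling L

Contains132 : ∀ {n} → (Fin n → ℕ) → Set
Contains132 {n} π = ∃[ a ] ∃[ b ] ∃[ c ]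
  (a Fin.< b × b Fin.< c × π a < π c × π c < π b)

Avoids132 : ∀ {n} → (Fin n → ℕ) → Set
Avoids132 π = ¬ Contains132 π

-- Within a diamond the least label lies below every other label. Hence if
-- a middle (or greatest) label at position j exceeded a later label at
-- position k, the least label, the label at j and the label at k would form
-- an occurrence of 132; equality is excluded because labels are distinct.
module Submission where

open import Defs
open import Data.Nat using (ℕ; _≤_; _<_; _*_; _∸_; z≤n; s≤s)
open import Data.Nat.Properties using (_≟_; <-cmp; <-trans; ≤-trans; <⇒≤; ≤-pred; ≤∧≢⇒<; +-monoʳ-<; n≢0⇒n>0)
open import Data.Fin as Fin using (Fin; toℕ; combine)
open import Data.Fin.Properties using (remQuot-combine; toℕ-combine; toℕ-fromℕ; toℕ<n; <⇒≢)
open import Data.Product using (_,_; proj₁; uncurry)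
open import Relation.Binary.PropositionalEquality using (_≡_; refl; sym; cong; subst₂)
open import Relation.Binary.Definitions using (tri<; tri≈; tri>)
open import Relation.Nullary using (Dec; yes; no; contradiction)

avoids132∧injective⇒<ʳ : ∀ {n} {π : Fin n → ℕ} → Avoids132 π →
  (∀ p q → π p ≡ π q → p ≡ q) →
  ∀ {a b c} → a Fin.< b → b Fin.< c → π a < π c → π b < π c
avoids132∧injective⇒<ʳ {π = π} avoids injective {a} {b} {c} a<b b<c πa<πc
  with <-cmp (π b) (π c)
... | tri< πb<πc _ _ = πb<πc
... | tri≈ _ πb≡πc _ = contradiction (injective b c πb≡πc) (<⇒≢ b<c)
... | tri> _ _ πc<πb = contradiction (a , b , c , a<b , b<c , πa<πc , πc<πb) avoids

πD-combine : ∀ {v d} (L : Labelling v d) i j → πD L (combine i j) ≡ L i j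
πD-combine {v} {d} L i j = cong (uncurry L) (remQuot-combine {d} {v} i j)

combine-monoʳ-< : ∀ {d v} (i : Fin d) {j k : Fin v} →
  toℕ j < toℕ k → combine i j Fin.< combine i k
combine-monoʳ-< {v = v} i {j} {k} j<k
  rewrite toℕ-combine i j | toℕ-combine i k = +-monoʳ-< (v * toℕ i) j<k

-- For k the greatest element we pass through the middle element 1, which
-- exists because v ≥ 3.
diamond⇒least<nonLeast : ∀ {v d} {L : Labelling v d} → IsDiamondLabelling L →
  3 ≤ v → (i : Fin d) (z k : Fin v) → toℕ z ≡ 0 → 0 < toℕ k → L i z < L i k
diamond⇒least<nonLeast {v} diamond (s≤s (s≤s (s≤s _))) i z k z≡0 0<k
  with toℕ k ≟ v ∸ 1
... | no k≢greatest =
  proj₁ (diamond i z k (Fin.fromℕ _) z≡0 (toℕ-fromℕ _) 0<k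
           (≤∧≢⇒< (≤-pred (toℕ<n k)) k≢greatest))
... | yes k≡greatest =
  let z<1 , 1<k = diamond i z (Fin.suc Fin.zero) k z≡0 k≡greatest (s≤s z≤n) (s≤s (s≤s z≤n))
  in <-trans z<1 1<k

lemma2p4 : (v d : ℕ) → 4 ≤ v → 1 ≤ d → (L : Labelling v d) →
    InD v d L → Avoids132 (πD L) →
    (i : Fin d) (j k : Fin v) → toℕ j < toℕ k →
      πD L (combine i j) < πD L (combine i k)
lemma2p4 v d 4≤v@(s≤s _) _ L ((_ , πD-injective) , diamond) avoids i j k j<k =
  splitOnLeast (toℕ j ≟ 0)
  where
  least<k : ∀ z → toℕ z ≡ 0 → πD L (combine i z) < πD L (combine i k)
  least<k z z≡0 = subst₂ _<_ (sym (πD-combine L i z)) (sym (πD-combine L i k))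
    (diamond⇒least<nonLeast diamond (<⇒≤ 4≤v) i z k z≡0 (≤-trans (s≤s z≤n) j<k))

  splitOnLeast : Dec (toℕ j ≡ 0) → πD L (combine i j) < πD L (combine i k)
  splitOnLeast (yes j≡0) = least<k j j≡0
  splitOnLeast (no j≢0)  = avoids132∧injective⇒<ʳ avoids πD-injective
    (combine-monoʳ-< i (n≢0⇒n>0 j≢0)) (combine-monoʳ-< i j<k) (least<k Fin.zero refl)
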